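{- Let $h \geq 4$ be an integer and let $A = \{a_1, \ldots, a_{h+1}\}$ be a set of positive integers with $a_1 < \cdots < a_{h+1}$. Assume $a_2 \not\equiv a_1 \pmod 2$ and $a_3 \equiv a_1 \pmod 2$. Let $A_2 = A \setminus \{a_2\}$. Then \[|h^{\wedge}_{\pm}A| \geq |h^{\wedge}_{\pm}A_2| + \frac{h(h+1)}{2} + h,\] and consequently \[|h^{\wedge}_{\pm}A| \geq \begin{cases} h^2 + 2h + 2, & \text{if } A_2 \text{ is not an arithmetic progression};\\ \frac{1}{2}h(3h-1) + 4, & \text{if } A_2 \text{ is an arithmetic progression and } a_2 \not\equiv 0 \pmod 2;\\ 26, & \text{if } h = 4,\ A_2 \text{ is an arithmetic progression and } a_2 \equiv 0 \pmod 2;\\ 2h(h-1), & \text{if } h \geq 5,\ A_2 \text{ is an arithmetic progression and } a_2 \equiv 0 \pmod 2. \end{cases}\]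
   Context: For a finite set $A = \{a_1, \ldots, a_k\}$ of integers (with distinct $a_i$) and a positive integer $h$, the restricted $h$-fold signed sumset is \[h^{\wedge}_{\pm}A = \left\{ \sum_{i=1}^{k} \lambda_i a_i : \lambda_i \in \{ -1,0,1\}, \ \sum_{i=1}^{k} |\lambda_i| = h \right\}.\] An arithmetic progression is a set of the form $\{a + id : i = 0, \ldots, m-1\}$ with $d \neq 0$. -}

module Defs where

open import Data.Nat using (ℕ; zero; suc; _<_)
open import Data.Integer using (ℤ; _+_; _*_; -_; +_; 0ℤ; _≟_)
open import Data.List using (List; []; _∷_; _++_; map; length; deduplicate)
open import Data.List.Membership.Propositional using (_∈_)
open import Data.Product using (Σ; ∃; _×_)
open import Function.Bundles using (_⇔_)
open import Relation.Binary.PropositionalEquality using (_≡_)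
open import Relation.Nullary using (¬_)

-- The list of all sums  Σ λᵢ xᵢ  with λᵢ ∈ {-1,0,1} and Σ |λᵢ| = h,
-- one entry per coefficient vector λ (so possibly with repetitions).
signedSums : ℕ → List ℤ → List ℤ
signedSums zero    _        = 0ℤ ∷ []
signedSums (suc h) []       = []
signedSums (suc h) (x ∷ xs) =
  signedSums (suc h) xs ++ (map (λ s → x + s) (signedSums h xs) ++ map (λ s → (- x) + s) (signedSums h xs))

signedSumsetCard : ℕ → List ℤ → ℕ
signedSumsetCard h xs = length (deduplicate _≟_ (signedSums h xs))

IsAP : List ℤ → Set
IsAP xs = Σ ℤ λ a → Σ ℤ λ d → Σ ℕ λ m →
  (¬ d ≡ 0ℤ) × (∀ x → (x ∈ xs) ⇔ (Σ ℕ λ i → (i < m) × (x ≡ a + (+ i) * d)))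

module Submission where

-- Every bound comes from explicit signed sums that are provably distinct. A coefficient word
-- assigns ⊖, ⊙ or ⊕ to each element; moving a ⊕ right past a ⊖, flipping leading ⊖'s, or
-- letting a leading zero hop over the second element raises the signed sum on every increasing
-- list of positive integers, so the sums along a chain of such steps strictly increase.
--
-- All sums in h^±A₂ ⊆ h^±A have the parity of a₀ + a₂ + ⋯ + a_h. Words that use a₁ and put their
-- zero on a₀ or a₂ (of equal parity) give sums of the other parity; a chain of h(h+3)/2 + 1 of
-- them is the first inequality, and a chain of h(h+1)/2 + 1 sums in h^±A₂ yields the second.
-- If A₂ is an arithmetic progression with difference d, its elements share a parity, so the sums
-- ±a₁ + s with s ∈ (h-1)^±A₂ avoid h^±A₂. On a progression a ⊕⊖ swap adds exactly 2d and moving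
-- the zero adds d, so doing one and undoing the other still raises the sum; this gives a chain of
-- h² - h + 2 such s. If moreover a₁ is even, a₀ is odd and, modulo 4, a sum over all of A₂ only
-- depends on the parity of its number of ⊖'s; one chain in each class gives h² - h + 2 sums in
-- h^±A₂, which with the previous ones yields the last bound.

open import Defs

module SignedSumChains where

  open import Data.Empty using (⊥; ⊥-elim)
  open import Data.Nat as ℕ using (ℕ; zero; suc; _≤_; _∸_; z≤n; s≤s)
  import Data.Nat.Properties as ℕ
  import Data.Nat.Tactic.RingSolver as ℕ-Ring
  open import Data.Integer as ℤ using (ℤ; +_; -_; 0ℤ; _+_; _-_; _*_; _<_; _≟_)
  import Data.Integer.Properties as ℤ
  open import Data.Integer.Divisibility.Signed using (_∣_; divides; ∣m∣n⇒∣m+n; ∣m∣n⇒∣m-n)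
  open import Data.Integer.Tactic.RingSolver using (solve-∀)
  open import Data.List using (List; []; _∷_; _++_; map; length; foldr; replicate; deduplicate)
  import Data.List.Properties as List
  open import Data.List.Membership.Propositional using (_∈_)
  open import Data.List.Membership.Propositional.Properties
    using (∈-++⁺ˡ; ∈-++⁺ʳ; ∈-++⁻; ∈-map⁺; ∈-map⁻; ∈-∃++; ∈-deduplicate⁺; ∈-deduplicate⁻)
  open import Data.List.Relation.Unary.Any using (here; there)
  open import Data.List.Relation.Unary.All as All using (All; []; _∷_)
  import Data.List.Relation.Unary.All.Properties as All
  open import Data.List.Relation.Unary.AllPairs as AllPairs using (AllPairs; _∷_)
  open import Data.List.Relation.Unary.Linked as Linked using (Linked; []; [-]; _∷_)
  import Data.List.Relation.Unary.Linked.Properties as Linked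
  open import Data.List.Relation.Unary.Unique.Propositional using (Unique; []; _∷_)
  import Data.List.Relation.Unary.Unique.Propositional.Properties as Unique
  open import Data.List.Relation.Unary.Unique.DecPropositional.Properties using (deduplicate-!)
  open import Data.List.Relation.Binary.Disjoint.Propositional using (Disjoint)
  open import Data.Product using (∃; ∃₂; _×_; _,_; proj₁; proj₂)
  open import Data.Sum using (_⊎_; inj₁; inj₂)
  open import Function.Bundles using (Equivalence)
  open import Relation.Nullary using (¬_; contradiction)
  open import Relation.Binary.Definitions using (tri<; tri≈; tri>)
  open import Relation.Binary.PropositionalEquality
    using (_≡_; _≢_; refl; sym; trans; cong; cong₂; subst; subst₂; module ≡-Reasoning)

  infix 4 _≡_⟨mod_⟩
  record _≡_⟨mod_⟩ (u v m : ℤ) : Set where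
    constructor congruent
    field divides-difference : m ∣ u - v
  open _≡_⟨mod_⟩ public

  ≡mod-refl : ∀ {m a} → a ≡ a ⟨mod m ⟩
  ≡mod-refl {a = a} = congruent (divides 0ℤ (ℤ.+-inverseʳ a))

  ≡mod-sym : ∀ {m a b} → a ≡ b ⟨mod m ⟩ → b ≡ a ⟨mod m ⟩
  ≡mod-sym {m} {a} {b} (congruent (divides q a-b≡qm)) =
    congruent (divides (- q) (trans (flip-sign a b) (trans (cong -_ a-b≡qm) (ℤ.neg-distribˡ-* q m))))
    where
    flip-sign : ∀ a b → b - a ≡ - (a - b)
    flip-sign = solve-∀

  ≡mod-trans : ∀ {m a b c} → a ≡ b ⟨mod m ⟩ → b ≡ c ⟨mod m ⟩ → a ≡ c ⟨mod m ⟩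
  ≡mod-trans {m} {a} {b} {c} (congruent m∣a-b) (congruent m∣b-c) =
    congruent (subst (m ∣_) (telescope a b c) (∣m∣n⇒∣m+n m∣a-b m∣b-c))
    where
    telescope : ∀ a b c → a - b + (b - c) ≡ a - c
    telescope = solve-∀

  ≡mod-+ : ∀ {m a b c d} → a ≡ b ⟨mod m ⟩ → c ≡ d ⟨mod m ⟩ → a + c ≡ b + d ⟨mod m ⟩
  ≡mod-+ {m} {a} {b} {c} {d} (congruent m∣a-b) (congruent m∣c-d) =
    congruent (subst (m ∣_) (regroup a b c d) (∣m∣n⇒∣m+n m∣a-b m∣c-d))
    where
    regroup : ∀ a b c d → a - b + (c - d) ≡ a + c - (b + d)
    regroup = solve-∀

  ≡mod-cancelʳ : ∀ {m a b} s → a + s ≡ b + s ⟨mod m ⟩ → a ≡ b ⟨mod m ⟩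
  ≡mod-cancelʳ {m} {a} {b} s (congruent m∣) = congruent (subst (m ∣_) (drop a b s) m∣)
    where
    drop : ∀ a b s → a + s - (b + s) ≡ a - b
    drop = solve-∀

  -x≡x : ∀ x → - x ≡ x ⟨mod + 2 ⟩
  -x≡x x = congruent (divides (- x) (double x))
    where
    double : ∀ x → - x - x ≡ - x * + 2
    double = solve-∀

  increment-< : ∀ {u v δ} → v ≡ u + δ → 0ℤ < δ → u < v
  increment-< {u} refl 0<δ = subst (_< u + _) (ℤ.+-identityʳ u) (ℤ.+-monoʳ-< u 0<δ)

  increment-≡mod : ∀ {u v δ m} → v ≡ u + δ → m ∣ δ → v ≡ u ⟨mod m ⟩
  increment-≡mod {u} {δ = δ} refl m∣δ = congruent (subst (_ ∣_) (cancel u δ) m∣δ)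
    where
    cancel : ∀ u δ → δ ≡ u + δ - u
    cancel = solve-∀

  0<double : ∀ {x} → 0ℤ < x → 0ℤ < + 2 * x
  0<double {x} 0<x = subst (0ℤ <_) (double x) (ℤ.+-mono-< 0<x 0<x)
    where
    double : ∀ x → x + x ≡ + 2 * x
    double = solve-∀

  0<difference : ∀ {x y} → x < y → 0ℤ < y - x
  0<difference {x} {y} x<y = subst (_< y - x) (ℤ.+-inverseʳ x) (ℤ.+-monoˡ-< (- x) x<y)

  data Consecutive (x y : ℤ) : List ℤ → Set where
    here  : ∀ {zs} → Consecutive x y (x ∷ y ∷ zs)
    there : ∀ {z zs} → Consecutive x y zs → Consecutive x y (z ∷ zs)

  Linked⇒consecutive : ∀ {P : ℤ → ℤ → Set} {x y zs} → Linked P zs → Consecutive x y zs → P x y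
  Linked⇒consecutive (Pxy ∷ _)   here      = Pxy
  Linked⇒consecutive (_ ∷ zs↑)   (there c) = Linked⇒consecutive zs↑ c

  consecutive⇒Linked : ∀ {P : ℤ → ℤ → Set} zs → (∀ {x y} → Consecutive x y zs → P x y) →
                       Linked P zs
  consecutive⇒Linked []           _   = []
  consecutive⇒Linked (x ∷ [])     _   = [-]
  consecutive⇒Linked (x ∷ y ∷ zs) gap = gap here ∷ consecutive⇒Linked (y ∷ zs) (λ c → gap (there c))

  consecutive-∈ˡ : ∀ {x y zs} → Consecutive x y zs → x ∈ zs
  consecutive-∈ˡ here      = here refl
  consecutive-∈ˡ (there c) = there (consecutive-∈ˡ c)

  consecutive-∈ʳ : ∀ {x y zs} → Consecutive x y zs → y ∈ zs
  consecutive-∈ʳ here      = there (here refl)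
  consecutive-∈ʳ (there c) = there (consecutive-∈ʳ c)

  nothing-between : ∀ {x y z zs} → AllPairs _<_ zs → Consecutive x y zs → z ∈ zs → x < z → z < y → ⊥
  nothing-between _                here      (here refl)         x<z _   = ℤ.<-irrefl refl x<z
  nothing-between _                here      (there (here refl)) _   z<y = ℤ.<-irrefl refl z<y
  nothing-between (_ ∷ y<zs ∷ _)   here      (there (there z∈))  _   z<y = ℤ.<-asym z<y (All.lookup y<zs z∈)
  nothing-between (w<zs ∷ _)       (there c) (here refl)         x<w _   =
    ℤ.<-asym x<w (All.lookup w<zs (consecutive-∈ˡ c))
  nothing-between (_ ∷ zs↑)        (there c) (there z∈)          x<z z<y = nothing-between zs↑ c z∈ x<z z<y

  -- Signed sums of coefficient words

  data Sign : Set where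
    ⊖ ⊙ ⊕ : Sign

  Word : Set
  Word = List Sign

  infix 8 _^_
  _^_ : Sign → ℕ → Word
  c ^ n = replicate n c

  ⟦_⟧ : Sign → ℤ → ℤ
  ⟦ ⊖ ⟧ x = - x
  ⟦ ⊙ ⟧ x = 0ℤ
  ⟦ ⊕ ⟧ x = x

  -- Junk value 0 when the lengths differ: every lemma below assumes length w ≡ length xs.
  signedSum : Word → List ℤ → ℤ
  signedSum (c ∷ w) (x ∷ xs) = ⟦ c ⟧ x + signedSum w xs
  signedSum _       _        = 0ℤ

  weight : Word → ℕ
  weight []      = 0
  weight (⊙ ∷ w) = weight w
  weight (_ ∷ w) = suc (weight w)

  weight-∷ : ∀ c w → weight (c ∷ w) ≡ weight (c ∷ []) ℕ.+ weight w
  weight-∷ ⊖ w = refl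
  weight-∷ ⊙ w = refl
  weight-∷ ⊕ w = refl

  ∈-signedSums-skip : ∀ k x {ys s} → s ∈ signedSums k ys → s ∈ signedSums k (x ∷ ys)
  ∈-signedSums-skip zero    x s∈ = s∈
  ∈-signedSums-skip (suc k) x s∈ = ∈-++⁺ˡ s∈

  ∈-signedSums-∷ : ∀ c x {k ys s} → s ∈ signedSums k ys →
                   ⟦ c ⟧ x + s ∈ signedSums (weight (c ∷ []) ℕ.+ k) (x ∷ ys)
  ∈-signedSums-∷ ⊖ x {k} {ys} s∈ =
    ∈-++⁺ʳ (signedSums (suc k) ys)
      (∈-++⁺ʳ (map (λ s → x + s) (signedSums k ys)) (∈-map⁺ (λ s → - x + s) s∈))
  ∈-signedSums-∷ ⊙ x {k} s∈ =
    subst (_∈ signedSums k (x ∷ _)) (sym (ℤ.+-identityˡ _)) (∈-signedSums-skip k x s∈)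
  ∈-signedSums-∷ ⊕ x {k} {ys} s∈ =
    ∈-++⁺ʳ (signedSums (suc k) ys) (∈-++⁺ˡ (∈-map⁺ (λ s → x + s) s∈))

  ∈-signedSums-∷⁻ : ∀ k x xs {v} → v ∈ signedSums (suc k) (x ∷ xs) →
                    v ∈ signedSums (suc k) xs ⊎
                    ∃ λ s → s ∈ signedSums k xs × (v ≡ x + s ⊎ v ≡ - x + s)
  ∈-signedSums-∷⁻ k x xs v∈ with ∈-++⁻ (signedSums (suc k) xs) v∈
  ... | inj₁ v∈xs = inj₁ v∈xs
  ... | inj₂ v∈± with ∈-++⁻ (map (λ s → x + s) (signedSums k xs)) v∈±
  ...   | inj₁ v∈+ with ∈-map⁻ (λ s → x + s) v∈+
  ...     | s , s∈ , refl = inj₂ (s , s∈ , inj₁ refl)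
  ∈-signedSums-∷⁻ k x xs v∈ | inj₂ _ | inj₂ v∈- with ∈-map⁻ (λ s → - x + s) v∈-
  ...     | s , s∈ , refl = inj₂ (s , s∈ , inj₂ refl)

  signedSum∈signedSums : ∀ w xs → length w ≡ length xs → signedSum w xs ∈ signedSums (weight w) xs
  signedSum∈signedSums []      []       _   = here refl
  signedSum∈signedSums (c ∷ w) (x ∷ xs) len =
    subst (λ k → signedSum (c ∷ w) (x ∷ xs) ∈ signedSums k (x ∷ xs)) (sym (weight-∷ c w))
      (∈-signedSums-∷ c x (signedSum∈signedSums w xs (ℕ.suc-injective len)))

  ∈-signedSums-insert : ∀ c k x y xs {v} → v ∈ signedSums k (x ∷ xs) →
                        ⟦ c ⟧ y + v ∈ signedSums (weight (c ∷ []) ℕ.+ k) (x ∷ y ∷ xs)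
  ∈-signedSums-insert c zero x y xs (here refl) =
    ∈-signedSums-skip (weight (c ∷ []) ℕ.+ 0) x (∈-signedSums-∷ c y (here refl))
  ∈-signedSums-insert c (suc k) x y xs v∈ with ∈-signedSums-∷⁻ k x xs v∈
  ... | inj₁ v∈xs = ∈-signedSums-skip (weight (c ∷ []) ℕ.+ suc k) x (∈-signedSums-∷ c y {ys = xs} v∈xs)
  ... | inj₂ (s , s∈ , inj₁ refl) =
    subst₂ (λ u k → u ∈ signedSums k (x ∷ y ∷ xs))
      (swap-front (⟦ c ⟧ y) x s) (sym (ℕ.+-suc (weight (c ∷ [])) k))
      (∈-signedSums-∷ ⊕ x {ys = y ∷ xs} (∈-signedSums-∷ c y {ys = xs} s∈))
    where
    swap-front : ∀ a x s → x + (a + s) ≡ a + (x + s)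
    swap-front = solve-∀
  ... | inj₂ (s , s∈ , inj₂ refl) =
    subst₂ (λ u k → u ∈ signedSums k (x ∷ y ∷ xs))
      (swap-front (⟦ c ⟧ y) x s) (sym (ℕ.+-suc (weight (c ∷ [])) k))
      (∈-signedSums-∷ ⊖ x {ys = y ∷ xs} (∈-signedSums-∷ c y {ys = xs} s∈))
    where
    swap-front : ∀ a x s → - x + (a + s) ≡ a + (- x + s)
    swap-front = solve-∀

  signedSums-beyond : ∀ k xs → signedSums (suc k ℕ.+ length xs) xs ≡ []
  signedSums-beyond k []       = refl
  signedSums-beyond k (x ∷ xs)
    rewrite ℕ.+-suc k (length xs) | signedSums-beyond (suc k) xs | signedSums-beyond k xs = refl

  signedSums-parity : ∀ xs {v} → v ∈ signedSums (length xs) xs → v ≡ foldr _+_ 0ℤ xs ⟨mod + 2 ⟩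
  signedSums-parity []       (here refl) = ≡mod-refl
  signedSums-parity (x ∷ xs) v∈ with ∈-signedSums-∷⁻ (length xs) x xs v∈
  ... | inj₁ v∈∅ = contradiction (subst (_ ∈_) (signedSums-beyond 0 xs) v∈∅) (λ ())
  ... | inj₂ (s , s∈ , inj₁ refl) = ≡mod-+ (≡mod-refl {a = x}) (signedSums-parity xs s∈)
  ... | inj₂ (s , s∈ , inj₂ refl) = ≡mod-+ (-x≡x x) (signedSums-parity xs s∈)

  private
    one-more : ∀ r k → r + k * r ≡ (+ 1 + k) * r
    one-more = solve-∀

  signedSums-uniform-parity : ∀ {r} k xs {v} → All (λ x → x ≡ r ⟨mod + 2 ⟩) xs →
                              v ∈ signedSums k xs → v ≡ + k * r ⟨mod + 2 ⟩
  signedSums-uniform-parity zero xs _ (here refl) = ≡mod-refl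
  signedSums-uniform-parity (suc k) (x ∷ xs) (x≡r ∷ xs≡r) v∈ with ∈-signedSums-∷⁻ k x xs v∈
  ... | inj₁ v∈xs = signedSums-uniform-parity (suc k) xs xs≡r v∈xs
  ... | inj₂ (s , s∈ , inj₁ refl) =
    subst (λ t → x + s ≡ t ⟨mod + 2 ⟩) (one-more _ (+ k))
      (≡mod-+ x≡r (signedSums-uniform-parity k xs xs≡r s∈))
  ... | inj₂ (s , s∈ , inj₂ refl) =
    subst (λ t → - x + s ≡ t ⟨mod + 2 ⟩) (one-more _ (+ k))
      (≡mod-+ (≡mod-trans (-x≡x x) x≡r) (signedSums-uniform-parity k xs xs≡r s∈))

  -- Counting distinct sums

  private
    ∈-remove : ∀ {u y : ℤ} pre post → u ∈ pre ++ y ∷ post → y ≢ u → u ∈ pre ++ post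
    ∈-remove []        post (here refl) y≢u = contradiction refl y≢u
    ∈-remove []        post (there u∈)  _   = u∈
    ∈-remove (_ ∷ pre) post (here refl) _   = here refl
    ∈-remove (_ ∷ pre) post (there u∈)  y≢u = there (∈-remove pre post u∈ y≢u)

    length-insert : ∀ {y : ℤ} pre post → length (pre ++ y ∷ post) ≡ suc (length (pre ++ post))
    length-insert []        post = refl
    length-insert (_ ∷ pre) post = cong suc (length-insert pre post)

  unique-length-≤ : ∀ {ys zs : List ℤ} → Unique ys → All (_∈ zs) ys → length ys ≤ length zs
  unique-length-≤ []           []             = z≤n
  unique-length-≤ {y ∷ ys} (y∉ys ∷ ys!) (y∈zs ∷ ys⊆zs) with ∈-∃++ y∈zs
  ... | pre , post , refl = begin
    suc (length ys)             ≤⟨ s≤s (unique-length-≤ ys! (All.zipWith remove (ys⊆zs , y∉ys))) ⟩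
    suc (length (pre ++ post))  ≡⟨ sym (length-insert pre post) ⟩
    length (pre ++ y ∷ post)    ∎
    where
    open ℕ.≤-Reasoning
    remove : ∀ {u} → u ∈ pre ++ y ∷ post × y ≢ u → u ∈ pre ++ post
    remove (u∈ , y≢u) = ∈-remove pre post u∈ y≢u

  unique-≤-signedSumsetCard : ∀ {k xs ys} → Unique ys → All (_∈ signedSums k xs) ys →
                              length ys ≤ signedSumsetCard k xs
  unique-≤-signedSumsetCard ys! ys⊆ = unique-length-≤ ys! (All.map (∈-deduplicate⁺ _≟_) ys⊆)

  signedSumsetCard-insert : ∀ {k x y xs zs} → Unique zs → All (_∈ signedSums k (x ∷ y ∷ xs)) zs →
                            Disjoint (signedSums k (x ∷ xs)) zs →
                            signedSumsetCard k (x ∷ xs) ℕ.+ length zs ≤ signedSumsetCard k (x ∷ y ∷ xs)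
  signedSumsetCard-insert {k} {x} {y} {xs} {zs} zs! zs⊆ disjoint =
    subst (_≤ signedSumsetCard k (x ∷ y ∷ xs)) (List.length-++ old)
      (unique-≤-signedSumsetCard {k} {x ∷ y ∷ xs}
        (Unique.++⁺ (deduplicate-! _≟_ _) zs! old-disjoint) (All.++⁺ old⊆ zs⊆))
    where
    old : List ℤ
    old = deduplicate _≟_ (signedSums k (x ∷ xs))
    old⊆ : All (_∈ signedSums k (x ∷ y ∷ xs)) old
    old⊆ = All.tabulate λ v∈ → subst (_∈ signedSums k (x ∷ y ∷ xs)) (ℤ.+-identityˡ _)
             (∈-signedSums-insert ⊙ k x y xs (∈-deduplicate⁻ _≟_ _ v∈))
    old-disjoint : Disjoint old zs
    old-disjoint (v∈ , v∈zs) = disjoint (∈-deduplicate⁻ _≟_ _ v∈ , v∈zs)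

  -- Moves that raise a signed sum

  private
    variable
      c : Sign
      v v′ w w′ : Word

  data Swap : Word → Word → Set where
    ⊕⊖    : Swap (⊕ ∷ ⊖ ∷ w) (⊖ ∷ ⊕ ∷ w)
    there : ∀ c → Swap w w′ → Swap (c ∷ w) (c ∷ w′)

  data Slide : Word → Word → Set where
    ⊙⊖    : Slide (⊙ ∷ ⊖ ∷ w) (⊖ ∷ ⊙ ∷ w)
    ⊕⊙    : Slide (⊕ ∷ ⊙ ∷ w) (⊙ ∷ ⊕ ∷ w)
    there : ∀ c → Slide w w′ → Slide (c ∷ w) (c ∷ w′)

  data Step : Word → Word → Set where
    swap : Swap w w′ → Step w w′
    flip : Step (⊖ ∷ w) (⊕ ∷ w)
    hop⁻ : Step (⊙ ∷ c ∷ ⊖ ∷ w) (⊖ ∷ c ∷ ⊙ ∷ w)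
    hop⁺ : Step (⊕ ∷ c ∷ ⊙ ∷ w) (⊙ ∷ c ∷ ⊕ ∷ w)

  data EvenStep : Word → Word → Set where
    swap  : Swap w w′ → EvenStep w w′
    flip₂ : EvenStep (⊖ ∷ ⊖ ∷ w) (⊕ ∷ ⊕ ∷ w)

  -- On an arithmetic progression with difference D a swap adds exactly 2D and a slide D, so a trade
  -- (swap from w, then undo the slide leading to w′) adds D.
  data APStep : Word → Word → Set where
    step  : Step w w′ → APStep w w′
    slide : Slide w w′ → APStep w w′
    trade : ∀ {u} → Swap w u → Slide w′ u → APStep w w′

  SameShape : Word → Word → Set
  SameShape w w′ = length w ≡ length w′ × weight w ≡ weight w′

  private
    weight-cong : ∀ c → weight w ≡ weight w′ → weight (c ∷ w) ≡ weight (c ∷ w′)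
    weight-cong ⊖ eq = cong suc eq
    weight-cong ⊙ eq = eq
    weight-cong ⊕ eq = cong suc eq

  Swap-shape : Swap w w′ → SameShape w w′
  Swap-shape ⊕⊖           = refl , refl
  Swap-shape (there c sw) with Swap-shape sw
  ... | len , wt = cong suc len , weight-cong c wt

  Slide-shape : Slide w w′ → SameShape w w′
  Slide-shape ⊙⊖           = refl , refl
  Slide-shape ⊕⊙           = refl , refl
  Slide-shape (there c sl) with Slide-shape sl
  ... | len , wt = cong suc len , weight-cong c wt

  Step-shape : Step w w′ → SameShape w w′
  Step-shape (swap sw)   = Swap-shape sw
  Step-shape flip        = refl , refl
  Step-shape (hop⁻ {⊖})  = refl , refl
  Step-shape (hop⁻ {⊙})  = refl , refl
  Step-shape (hop⁻ {⊕})  = refl , refl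
  Step-shape (hop⁺ {⊖})  = refl , refl
  Step-shape (hop⁺ {⊙})  = refl , refl
  Step-shape (hop⁺ {⊕})  = refl , refl

  EvenStep-shape : EvenStep w w′ → SameShape w w′
  EvenStep-shape (swap sw) = Swap-shape sw
  EvenStep-shape flip₂     = refl , refl

  APStep-shape : APStep w w′ → SameShape w w′
  APStep-shape (step st)     = Step-shape st
  APStep-shape (slide sl)    = Slide-shape sl
  APStep-shape (trade sw sl) with Swap-shape sw | Slide-shape sl
  ... | len , wt | len′ , wt′ = trans len (sym len′) , trans wt (sym wt′)

  private
    signedSum-∷ : ∀ c x xs w w′ δ → signedSum w′ xs ≡ signedSum w xs + δ →
                  signedSum (c ∷ w′) (x ∷ xs) ≡ signedSum (c ∷ w) (x ∷ xs) + δ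
    signedSum-∷ c x xs w w′ δ eq =
      trans (cong (λ s → ⟦ c ⟧ x + s) eq) (sym (ℤ.+-assoc (⟦ c ⟧ x) _ δ))

  Swap-increment : ∀ {xs} → Swap w w′ → length w ≡ length xs →
                   ∃₂ λ x y → Consecutive x y xs × signedSum w′ xs ≡ signedSum w xs + + 2 * (y - x)
  Swap-increment {w = ⊕ ∷ ⊖ ∷ v} {xs = x ∷ y ∷ xs} ⊕⊖ _ = x , y , here , shift x y (signedSum v xs)
    where
    shift : ∀ x y s → - x + (y + s) ≡ x + (- y + s) + + 2 * (y - x)
    shift = solve-∀
  Swap-increment {w = c ∷ v} {w′ = c ∷ v′} {xs = x ∷ xs} (there c sw) len
    with Swap-increment sw (ℕ.suc-injective len)
  ... | x′ , y , xy , inc = x′ , y , there xy , signedSum-∷ c x xs v v′ _ inc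

  Slide-increment : ∀ {xs} → Slide w w′ → length w ≡ length xs →
                    ∃₂ λ x y → Consecutive x y xs × signedSum w′ xs ≡ signedSum w xs + (y - x)
  Slide-increment {w = ⊙ ∷ ⊖ ∷ v} {xs = x ∷ y ∷ xs} ⊙⊖ _ = x , y , here , shift x y (signedSum v xs)
    where
    shift : ∀ x y s → - x + (0ℤ + s) ≡ 0ℤ + (- y + s) + (y - x)
    shift = solve-∀
  Slide-increment {w = ⊕ ∷ ⊙ ∷ v} {xs = x ∷ y ∷ xs} ⊕⊙ _ = x , y , here , shift x y (signedSum v xs)
    where
    shift : ∀ x y s → 0ℤ + (y + s) ≡ x + (0ℤ + s) + (y - x)
    shift = solve-∀
  Slide-increment {w = c ∷ v} {w′ = c ∷ v′} {xs = x ∷ xs} (there c sl) len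
    with Slide-increment sl (ℕ.suc-injective len)
  ... | x′ , y , xy , inc = x′ , y , there xy , signedSum-∷ c x xs v v′ _ inc

  private
    flip-increment : ∀ x s → x + s ≡ - x + s + + 2 * x
    flip-increment = solve-∀

    flip₂-increment : ∀ x y s → x + (y + s) ≡ - x + (- y + s) + + 2 * (x + y)
    flip₂-increment = solve-∀

    hop⁻-increment : ∀ x₀ k x₂ s → - x₀ + (k + (0ℤ + s)) ≡ 0ℤ + (k + (- x₂ + s)) + (x₂ - x₀)
    hop⁻-increment = solve-∀

    hop⁺-increment : ∀ x₀ k x₂ s → 0ℤ + (k + (x₂ + s)) ≡ x₀ + (k + (0ℤ + s)) + (x₂ - x₀)
    hop⁺-increment = solve-∀

  Step-raises : ∀ {xs} → Step w w′ → length w ≡ length xs → Linked _<_ xs → All (0ℤ <_) xs →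
                signedSum w xs < signedSum w′ xs
  Step-raises (swap sw) len xs↑ _ with Swap-increment sw len
  ... | _ , _ , xy , inc = increment-< inc (0<double (0<difference (Linked⇒consecutive xs↑ xy)))
  Step-raises {w = ⊖ ∷ v} {xs = x ∷ xs} flip _ _ (0<x ∷ _) =
    increment-< (flip-increment x (signedSum v xs)) (0<double 0<x)
  Step-raises {w = ⊙ ∷ c ∷ ⊖ ∷ v} {xs = x₀ ∷ x₁ ∷ x₂ ∷ xs} hop⁻ _ (x₀<x₁ ∷ x₁<x₂ ∷ _) _ =
    increment-< (hop⁻-increment x₀ (⟦ c ⟧ x₁) x₂ (signedSum v xs))
      (0<difference (ℤ.<-trans x₀<x₁ x₁<x₂))
  Step-raises {w = ⊕ ∷ c ∷ ⊙ ∷ v} {xs = x₀ ∷ x₁ ∷ x₂ ∷ xs} hop⁺ _ (x₀<x₁ ∷ x₁<x₂ ∷ _) _ =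
    increment-< (hop⁺-increment x₀ (⟦ c ⟧ x₁) x₂ (signedSum v xs))
      (0<difference (ℤ.<-trans x₀<x₁ x₁<x₂))

  Step-even : ∀ {x₀ x₁ x₂ xs} → let ys = x₀ ∷ x₁ ∷ x₂ ∷ xs in
              Step w w′ → length w ≡ length ys → x₂ ≡ x₀ ⟨mod + 2 ⟩ →
              signedSum w′ ys ≡ signedSum w ys ⟨mod + 2 ⟩
  Step-even (swap sw) len _ with Swap-increment sw len
  ... | x , y , _ , inc = increment-≡mod inc (divides (y - x) (ℤ.*-comm (+ 2) (y - x)))
  Step-even {w = ⊖ ∷ v} {x₀ = x₀} {x₁} {x₂} {xs} flip _ _ =
    increment-≡mod (flip-increment x₀ (signedSum v (x₁ ∷ x₂ ∷ xs))) (divides x₀ (ℤ.*-comm (+ 2) x₀))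
  Step-even {w = ⊙ ∷ c ∷ ⊖ ∷ v} {x₀ = x₀} {x₁} {x₂} {xs} hop⁻ _ x₂≡x₀ =
    increment-≡mod (hop⁻-increment x₀ (⟦ c ⟧ x₁) x₂ (signedSum v xs)) (divides-difference x₂≡x₀)
  Step-even {w = ⊕ ∷ c ∷ ⊙ ∷ v} {x₀ = x₀} {x₁} {x₂} {xs} hop⁺ _ x₂≡x₀ =
    increment-≡mod (hop⁺-increment x₀ (⟦ c ⟧ x₁) x₂ (signedSum v xs)) (divides-difference x₂≡x₀)

  EvenStep-raises : ∀ {xs} → EvenStep w w′ → length w ≡ length xs → Linked _<_ xs → All (0ℤ <_) xs →
                    signedSum w xs < signedSum w′ xs
  EvenStep-raises (swap sw) len xs↑ _ with Swap-increment sw len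
  ... | _ , _ , xy , inc = increment-< inc (0<double (0<difference (Linked⇒consecutive xs↑ xy)))
  EvenStep-raises {w = ⊖ ∷ ⊖ ∷ v} {xs = x ∷ y ∷ xs} flip₂ _ _ (0<x ∷ 0<y ∷ _) =
    increment-< (flip₂-increment x y (signedSum v xs)) (0<double (ℤ.+-mono-< 0<x 0<y))

  EvenStep-mod4 : ∀ {xs} → EvenStep w w′ → length w ≡ length xs →
                  Linked (λ x y → x ≡ y ⟨mod + 2 ⟩) xs → signedSum w′ xs ≡ signedSum w xs ⟨mod + 4 ⟩
  EvenStep-mod4 (swap sw) len xs≡ with Swap-increment sw len
  ... | x , y , xy , inc with Linked⇒consecutive xs≡ xy
  ...   | congruent (divides q x-y≡q2) = increment-≡mod inc (divides (- q) (quadruple x y q x-y≡q2))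
    where
    quadruple : ∀ x y q → x - y ≡ q * + 2 → + 2 * (y - x) ≡ - q * + 4
    quadruple x y q eq = trans (reorder x y) (trans (cong (λ d → - d * + 2) eq) (regroup q))
      where
      reorder : ∀ x y → + 2 * (y - x) ≡ - (x - y) * + 2
      reorder = solve-∀
      regroup : ∀ q → - (q * + 2) * + 2 ≡ - q * + 4
      regroup = solve-∀
  EvenStep-mod4 {w = ⊖ ∷ ⊖ ∷ v} {xs = x ∷ y ∷ xs} flip₂ _ (congruent (divides q x-y≡q2) ∷ _) =
    increment-≡mod (flip₂-increment x y (signedSum v xs)) (divides (q + y) (quadruple x y q x-y≡q2))
    where
    quadruple : ∀ x y q → x - y ≡ q * + 2 → + 2 * (x + y) ≡ (q + y) * + 4
    quadruple x y q eq = trans (reorder x y) (trans (cong (λ d → (d + y * + 2) * + 2) eq) (regroup q y))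
      where
      reorder : ∀ x y → + 2 * (x + y) ≡ ((x - y) + y * + 2) * + 2
      reorder = solve-∀
      regroup : ∀ q y → (q * + 2 + y * + 2) * + 2 ≡ (q + y) * + 4
      regroup = solve-∀

  APStep-raises : ∀ {xs D} → APStep w w′ → length w ≡ length xs →
                  Linked (λ x y → y ≡ x + D) xs → 0ℤ < D → All (0ℤ <_) xs →
                  signedSum w xs < signedSum w′ xs
  APStep-raises (step st) len xs-ap 0<D xs>0 =
    Step-raises st len (Linked.map (λ y≡x+D → increment-< y≡x+D 0<D) xs-ap) xs>0
  APStep-raises {w = w} {xs = xs} {D} (slide sl) len xs-ap 0<D _ with Slide-increment sl len
  ... | x , y , xy , inc with Linked⇒consecutive xs-ap xy
  ...   | refl = increment-< (trans inc (cong (λ δ → signedSum w xs + δ) (cancel x D))) 0<D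
    where
    cancel : ∀ x D → x + D - x ≡ D
    cancel = solve-∀
  APStep-raises {w = w} {w′ = w′} {xs = xs} {D} (trade {u = u} sw sl) len xs-ap 0<D _
    with Swap-increment sw len
       | Slide-increment sl (trans (proj₁ (Slide-shape sl)) (trans (sym (proj₁ (Swap-shape sw))) len))
  ... | x , _ , xy , up | x′ , _ , x′y′ , down
    with Linked⇒consecutive xs-ap xy | Linked⇒consecutive xs-ap x′y′
  ...   | refl | refl = increment-< (net (signedSum w xs) (signedSum w′ xs) (signedSum u xs) x x′ D up down) 0<D
    where
    net : ∀ v v′ u x x′ D → u ≡ v + + 2 * (x + D - x) → u ≡ v′ + (x′ + D - x′) → v′ ≡ v + D
    net v v′ u x x′ D up down = begin
      v′                          ≡⟨ pad v′ x′ D ⟩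
      v′ + (x′ + D - x′) - D      ≡⟨ cong (λ t → t - D) (sym down) ⟩
      u - D                       ≡⟨ cong (λ t → t - D) up ⟩
      v + + 2 * (x + D - x) - D   ≡⟨ unpad v x D ⟩
      v + D                       ∎
      where
      open ≡-Reasoning
      pad : ∀ v′ x′ D → v′ ≡ v′ + (x′ + D - x′) - D
      pad = solve-∀
      unpad : ∀ v x D → v + + 2 * (x + D - x) - D ≡ v + D
      unpad = solve-∀

  -- Chains of words

  swap-under : ∀ p → Swap w w′ → Swap (p ++ w) (p ++ w′)
  swap-under []      s = s
  swap-under (c ∷ p) s = there c (swap-under p s)

  swap-grow : ∀ n → Swap w (c ∷ w′) → Swap (c ^ n ++ w) (c ^ suc n ++ w′)
  swap-grow         zero    s = s
  swap-grow {c = c} (suc n) s = there c (swap-grow n s)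

  slide-under : ∀ p → Slide w w′ → Slide (p ++ w) (p ++ w′)
  slide-under []      s = s
  slide-under (c ∷ p) s = there c (slide-under p s)

  slide-grow : ∀ n → Slide w (c ∷ w′) → Slide (c ^ n ++ w) (c ^ suc n ++ w′)
  slide-grow         zero    s = s
  slide-grow {c = c} (suc n) s = there c (slide-grow n s)

  advance : ∀ p x v → Swap (p ++ ⊖ ^ x ++ ⊕ ∷ ⊖ ∷ v) (p ++ ⊖ ^ suc x ++ ⊕ ∷ v)
  advance p x v = swap-under p (swap-grow x ⊕⊖)

  march : Word → Sign → ℕ → ℕ → Word → List Word → List Word
  march p c x k t rest = (p ++ ⊖ ^ x ++ c ∷ ⊖ ^ k ++ t) ∷ onward k
    where
    onward : ℕ → List Word
    onward zero    = rest
    onward (suc k) = march p c (suc x) k t rest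

  march-linked : ∀ {R : Word → Word → Set} p c →
                 (∀ x v → R (p ++ ⊖ ^ x ++ c ∷ ⊖ ∷ v) (p ++ ⊖ ^ suc x ++ c ∷ v)) →
                 ∀ x k t rest → Linked R ((p ++ ⊖ ^ (x ℕ.+ k) ++ c ∷ t) ∷ rest) →
                 Linked R (march p c x k t rest)
  march-linked {R} p c move x zero t rest last =
    subst (λ n → Linked R ((p ++ ⊖ ^ n ++ c ∷ t) ∷ rest)) (ℕ.+-identityʳ x) last
  march-linked {R} p c move x (suc k) t rest last =
    move x (⊖ ^ k ++ t) ∷
    march-linked p c move (suc x) k t rest
      (subst (λ n → Linked R ((p ++ ⊖ ^ n ++ c ∷ t) ∷ rest)) (ℕ.+-suc x k) last)

  length-march : ∀ p c x k t rest → length (march p c x k t rest) ≡ suc k ℕ.+ length rest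
  length-march p c x zero    t rest = refl
  length-march p c x (suc k) t rest = cong suc (length-march p c (suc x) k t rest)

  ascent : ℕ → ℕ → List Word
  ascent k q = march [] ⊕ 0 k (⊕ ^ q) (onward k)
    where
    onward : ℕ → List Word
    onward zero    = []
    onward (suc k) = ascent k (suc q)

  ascent-linked : ∀ k q → Linked Step (ascent k q)
  ascent-linked zero    q = march-linked [] ⊕ (λ x v → swap (advance [] x v)) 0 0 (⊕ ^ q) [] [-]
  ascent-linked (suc k) q =
    march-linked [] ⊕ (λ x v → swap (advance [] x v)) 0 (suc k) (⊕ ^ q) _ (flip ∷ ascent-linked k (suc q))

  length-ascent : ∀ k q → 2 ℕ.* length (ascent k q) ≡ suc k ℕ.* suc (suc k)
  length-ascent zero    q = refl
  length-ascent (suc k) q = begin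
    2 ℕ.* length (ascent (suc k) q)
      ≡⟨ cong (2 ℕ.*_) (length-march [] ⊕ 0 (suc k) (⊕ ^ q) _) ⟩
    2 ℕ.* (suc (suc k) ℕ.+ length (ascent k (suc q)))
      ≡⟨ ℕ.*-distribˡ-+ 2 (suc (suc k)) _ ⟩
    2 ℕ.* suc (suc k) ℕ.+ 2 ℕ.* length (ascent k (suc q))
      ≡⟨ cong (2 ℕ.* suc (suc k) ℕ.+_) (length-ascent k (suc q)) ⟩
    2 ℕ.* suc (suc k) ℕ.+ suc k ℕ.* suc (suc k)
      ≡⟨ triangle k ⟩
    suc (suc k) ℕ.* suc (suc (suc k))
      ∎
    where
    open ≡-Reasoning
    triangle : ∀ k → 2 ℕ.* suc (suc k) ℕ.+ suc k ℕ.* suc (suc k) ≡ suc (suc k) ℕ.* suc (suc (suc k))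
    triangle = ℕ-Ring.solve-∀

  -- Ladder heads end in ⊕ ^ 0 or [] so that their first step reaches the next word definitionally.
  ladder : ℕ → List Word
  ladder n = (⊖ ^ suc n ++ ⊕ ^ 0) ∷ ascent n 0

  ladder-linked : ∀ n → Linked Step (ladder n)
  ladder-linked n = flip ∷ ascent-linked n 0

  length-ladder : ∀ n → 2 ℕ.* length (ladder n) ≡ suc n ℕ.* suc (suc n) ℕ.+ 2
  length-ladder n = begin
    2 ℕ.* suc (length (ascent n 0))    ≡⟨ ℕ.*-suc 2 (length (ascent n 0)) ⟩
    2 ℕ.+ 2 ℕ.* length (ascent n 0)    ≡⟨ cong (2 ℕ.+_) (length-ascent n 0) ⟩
    2 ℕ.+ suc n ℕ.* suc (suc n)        ≡⟨ ℕ.+-comm 2 _ ⟩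
    suc n ℕ.* suc (suc n) ℕ.+ 2        ∎
    where open ≡-Reasoning

  transit : ℕ → ℕ → List Word
  transit k q = (⊖ ∷ ⊕ ∷ ⊙ ∷ ⊖ ^ k ++ ⊕ ^ q) ∷ (⊕ ∷ ⊕ ∷ ⊙ ∷ ⊖ ^ k ++ ⊕ ^ q) ∷
                march (⊙ ∷ ⊕ ∷ []) ⊕ 0 k (⊕ ^ q) (onward k)
    where
    onward : ℕ → List Word
    onward zero    = []
    onward (suc k) = transit k (suc q)

  transit-linked : ∀ k q → Linked Step (transit k q)
  transit-linked zero    q =
    flip ∷ hop⁺ ∷ march-linked (⊙ ∷ ⊕ ∷ []) ⊕ (λ x v → swap (advance (⊙ ∷ ⊕ ∷ []) x v))
                    0 0 (⊕ ^ q) [] [-]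
  transit-linked (suc k) q =
    flip ∷ hop⁺ ∷ march-linked (⊙ ∷ ⊕ ∷ []) ⊕ (λ x v → swap (advance (⊙ ∷ ⊕ ∷ []) x v))
                    0 (suc k) (⊕ ^ q) _ (hop⁻ ∷ transit-linked k (suc q))

  length-transit : ∀ k q → 2 ℕ.* length (transit k q) ≡ suc k ℕ.* (k ℕ.+ 6)
  length-transit zero    q = refl
  length-transit (suc k) q = begin
    2 ℕ.* length (transit (suc k) q)
      ≡⟨ cong (λ l → 2 ℕ.* (2 ℕ.+ l)) (length-march (⊙ ∷ ⊕ ∷ []) ⊕ 0 (suc k) (⊕ ^ q) _) ⟩
    2 ℕ.* (2 ℕ.+ (suc (suc k) ℕ.+ length (transit k (suc q))))
      ≡⟨ regroup k (length (transit k (suc q))) ⟩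
    2 ℕ.* (k ℕ.+ 4) ℕ.+ 2 ℕ.* length (transit k (suc q))
      ≡⟨ cong (2 ℕ.* (k ℕ.+ 4) ℕ.+_) (length-transit k (suc q)) ⟩
    2 ℕ.* (k ℕ.+ 4) ℕ.+ suc k ℕ.* (k ℕ.+ 6)
      ≡⟨ expand k ⟩
    suc (suc k) ℕ.* (suc k ℕ.+ 6)
      ∎
    where
    open ≡-Reasoning
    regroup : ∀ k l → 2 ℕ.* (2 ℕ.+ (suc (suc k) ℕ.+ l)) ≡ 2 ℕ.* (k ℕ.+ 4) ℕ.+ 2 ℕ.* l
    regroup = ℕ-Ring.solve-∀
    expand : ∀ k → 2 ℕ.* (k ℕ.+ 4) ℕ.+ suc k ℕ.* (k ℕ.+ 6) ≡ suc (suc k) ℕ.* (suc k ℕ.+ 6)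
    expand = ℕ-Ring.solve-∀

  hopLadder : ℕ → List Word
  hopLadder n = (⊙ ∷ ⊖ ^ suc (suc n) ++ ⊕ ^ 0) ∷ (⊖ ∷ ⊖ ∷ ⊙ ∷ ⊖ ^ n ++ ⊕ ^ 0) ∷
                (⊕ ∷ ⊖ ∷ ⊙ ∷ ⊖ ^ n ++ ⊕ ^ 0) ∷ transit n 0

  hopLadder-linked : ∀ n → Linked Step (hopLadder n)
  hopLadder-linked n = hop⁻ ∷ flip ∷ swap ⊕⊖ ∷ transit-linked n 0

  length-hopLadder : ∀ n → 2 ℕ.* length (hopLadder n) ≡ (n ℕ.+ 3) ℕ.* (n ℕ.+ 4)
  length-hopLadder n = begin
    2 ℕ.* (3 ℕ.+ length (transit n 0))  ≡⟨ ℕ.*-distribˡ-+ 2 3 (length (transit n 0)) ⟩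
    6 ℕ.+ 2 ℕ.* length (transit n 0)    ≡⟨ cong (6 ℕ.+_) (length-transit n 0) ⟩
    6 ℕ.+ suc n ℕ.* (n ℕ.+ 6)           ≡⟨ expand n ⟩
    (n ℕ.+ 3) ℕ.* (n ℕ.+ 4)             ∎
    where
    open ≡-Reasoning
    expand : ∀ n → 6 ℕ.+ suc n ℕ.* (n ℕ.+ 6) ≡ (n ℕ.+ 3) ℕ.* (n ℕ.+ 4)
    expand = ℕ-Ring.solve-∀

  crawl : ℕ → ℕ → Word → List Word → List Word
  crawl x s t rest = (⊖ ^ x ++ ⊕ ∷ ⊕ ∷ ⊖ ^ s ++ t) ∷ onward s
    where
    onward : ℕ → List Word
    onward zero    = rest
    onward (suc s) = (⊖ ^ x ++ ⊕ ∷ ⊖ ∷ ⊕ ∷ ⊖ ^ s ++ t) ∷ crawl (suc x) s t rest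

  crawl-linked : ∀ x s t rest → Linked EvenStep ((⊖ ^ (x ℕ.+ s) ++ ⊕ ∷ ⊕ ∷ t) ∷ rest) →
                 Linked EvenStep (crawl x s t rest)
  crawl-linked x zero t rest last =
    subst (λ n → Linked EvenStep ((⊖ ^ n ++ ⊕ ∷ ⊕ ∷ t) ∷ rest)) (ℕ.+-identityʳ x) last
  crawl-linked x (suc s) t rest last =
    swap (swap-under (⊖ ^ x) (there ⊕ ⊕⊖)) ∷ swap (advance [] x (⊕ ∷ ⊖ ^ s ++ t)) ∷
    crawl-linked (suc x) s t rest
      (subst (λ n → Linked EvenStep ((⊖ ^ n ++ ⊕ ∷ ⊕ ∷ t) ∷ rest)) (ℕ.+-suc x s) last)

  length-crawl : ∀ x s t rest → length (crawl x s t rest) ≡ suc (2 ℕ.* s) ℕ.+ length rest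
  length-crawl x zero    t rest = refl
  length-crawl x (suc s) t rest =
    trans (cong (λ l → suc (suc l)) (length-crawl (suc x) s t rest)) (shift s (length rest))
    where
    shift : ∀ s l → suc (suc (suc (2 ℕ.* s) ℕ.+ l)) ≡ suc (2 ℕ.* suc s) ℕ.+ l
    shift = ℕ-Ring.solve-∀

  crawls : ℕ → Word → List Word
  crawls s t = crawl 0 s t (onward s)
    where
    onward : ℕ → List Word
    onward (suc (suc s)) = crawls s (⊕ ∷ ⊕ ∷ t)
    onward _             = []

  crawls-linked : ∀ s t → Linked EvenStep (crawls s t)
  crawls-linked zero          t = crawl-linked 0 0 t [] [-]
  crawls-linked (suc zero)    t = crawl-linked 0 1 t [] [-]
  crawls-linked (suc (suc s)) t = crawl-linked 0 (suc (suc s)) t _ (flip₂ ∷ crawls-linked s (⊕ ∷ ⊕ ∷ t))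

  length-crawls : ∀ s t t′ →
                  length (crawls s t) ℕ.+ length (crawls (suc s) t′) ≡ suc (suc s) ℕ.* suc (suc s)
  length-crawls zero          t t′ = refl
  length-crawls (suc zero)    t t′ = refl
  length-crawls (suc (suc s)) t t′ = begin
    length (crawls (2 ℕ.+ s) t) ℕ.+ length (crawls (3 ℕ.+ s) t′)
      ≡⟨ cong₂ ℕ._+_ (length-crawl 0 (2 ℕ.+ s) t _) (length-crawl 0 (3 ℕ.+ s) t′ _) ⟩
    (suc (2 ℕ.* (2 ℕ.+ s)) ℕ.+ l) ℕ.+ (suc (2 ℕ.* (3 ℕ.+ s)) ℕ.+ l′)
      ≡⟨ regroup s l l′ ⟩
    (4 ℕ.* s ℕ.+ 12) ℕ.+ (l ℕ.+ l′)
      ≡⟨ cong ((4 ℕ.* s ℕ.+ 12) ℕ.+_) (length-crawls s (⊕ ∷ ⊕ ∷ t) (⊕ ∷ ⊕ ∷ t′)) ⟩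
    (4 ℕ.* s ℕ.+ 12) ℕ.+ suc (suc s) ℕ.* suc (suc s)
      ≡⟨ expand s ⟩
    (4 ℕ.+ s) ℕ.* (4 ℕ.+ s)
      ∎
    where
    open ≡-Reasoning
    l l′ : ℕ
    l  = length (crawls s (⊕ ∷ ⊕ ∷ t))
    l′ = length (crawls (suc s) (⊕ ∷ ⊕ ∷ t′))
    regroup : ∀ s l l′ → (suc (2 ℕ.* (2 ℕ.+ s)) ℕ.+ l) ℕ.+ (suc (2 ℕ.* (3 ℕ.+ s)) ℕ.+ l′) ≡
                         (4 ℕ.* s ℕ.+ 12) ℕ.+ (l ℕ.+ l′)
    regroup = ℕ-Ring.solve-∀
    expand : ∀ s → (4 ℕ.* s ℕ.+ 12) ℕ.+ suc (suc s) ℕ.* suc (suc s) ≡ (4 ℕ.+ s) ℕ.* (4 ℕ.+ s)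
    expand = ℕ-Ring.solve-∀

  evenLadder : ℕ → List Word
  evenLadder n = (⊖ ^ suc (suc n) ++ []) ∷ crawls n []

  evenLadder-linked : ∀ n → Linked EvenStep (evenLadder n)
  evenLadder-linked n = flip₂ ∷ crawls-linked n []

  oddLadder : ℕ → List Word
  oddLadder n = march [] ⊕ 0 (suc (suc n)) [] (crawls n (⊕ ∷ []))

  oddLadder-linked : ∀ n → Linked EvenStep (oddLadder n)
  oddLadder-linked n =
    march-linked [] ⊕ (λ x v → swap (advance [] x v)) 0 (suc (suc n)) [] _
      (flip₂ ∷ crawls-linked n (⊕ ∷ []))

  length-ladders : ∀ n → length (evenLadder (suc n)) ℕ.+ length (oddLadder n) ≡
                         (n ℕ.+ 2) ℕ.* (n ℕ.+ 2) ℕ.+ (n ℕ.+ 4)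
  length-ladders n = begin
    suc (length (crawls (suc n) [])) ℕ.+ length (march [] ⊕ 0 (suc (suc n)) [] (crawls n (⊕ ∷ [])))
      ≡⟨ cong (suc (length (crawls (suc n) [])) ℕ.+_) (length-march [] ⊕ 0 (suc (suc n)) [] _) ⟩
    suc (length (crawls (suc n) [])) ℕ.+ (3 ℕ.+ n ℕ.+ length (crawls n (⊕ ∷ [])))
      ≡⟨ regroup n (length (crawls (suc n) [])) (length (crawls n (⊕ ∷ []))) ⟩
    n ℕ.+ 4 ℕ.+ (length (crawls n (⊕ ∷ [])) ℕ.+ length (crawls (suc n) []))
      ≡⟨ cong (n ℕ.+ 4 ℕ.+_) (length-crawls n (⊕ ∷ []) []) ⟩
    n ℕ.+ 4 ℕ.+ suc (suc n) ℕ.* suc (suc n)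
      ≡⟨ expand n ⟩
    (n ℕ.+ 2) ℕ.* (n ℕ.+ 2) ℕ.+ (n ℕ.+ 4)
      ∎
    where
    open ≡-Reasoning
    regroup : ∀ n l l′ → suc l ℕ.+ (3 ℕ.+ n ℕ.+ l′) ≡ n ℕ.+ 4 ℕ.+ (l′ ℕ.+ l)
    regroup = ℕ-Ring.solve-∀
    expand : ∀ n → n ℕ.+ 4 ℕ.+ suc (suc n) ℕ.* suc (suc n) ≡ (n ℕ.+ 2) ℕ.* (n ℕ.+ 2) ℕ.+ (n ℕ.+ 4)
    expand = ℕ-Ring.solve-∀

  pivot : ℕ → ℕ → ℕ → Word
  pivot x y q = ⊖ ^ x ++ ⊕ ∷ ⊖ ^ y ++ ⊙ ∷ ⊕ ^ q

  walk : ℕ → ℕ → ℕ → List Word → List Word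
  walk x y q rest = pivot x y q ∷ onward y
    where
    onward : ℕ → List Word
    onward zero          = rest
    onward (suc zero)    = walk (suc x) 0 q rest
    onward (suc (suc y)) = (⊖ ^ suc x ++ ⊕ ∷ ⊖ ^ y ++ ⊙ ∷ ⊖ ∷ ⊕ ^ q) ∷ walk (suc x) (suc y) q rest

  walk-linked : ∀ x y q rest → Linked APStep (pivot (x ℕ.+ y) 0 q ∷ rest) → Linked APStep (walk x y q rest)
  walk-linked x zero q rest last = subst (λ n → Linked APStep (pivot n 0 q ∷ rest)) (ℕ.+-identityʳ x) last
  walk-linked x (suc zero) q rest last =
    step (swap (advance [] x (⊙ ∷ ⊕ ^ q))) ∷
    subst (λ n → Linked APStep (pivot n 0 q ∷ rest)) (ℕ.+-comm x 1) last
  walk-linked x (suc (suc y)) q rest last =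
    trade (advance [] x (⊖ ∷ ⊖ ^ y ++ ⊙ ∷ ⊕ ^ q)) sink ∷ slide sink ∷
    walk-linked (suc x) (suc y) q rest
      (subst (λ n → Linked APStep (pivot n 0 q ∷ rest)) (ℕ.+-suc x (suc y)) last)
    where
    sink : Slide (⊖ ^ suc x ++ ⊕ ∷ ⊖ ^ y ++ ⊙ ∷ ⊖ ∷ ⊕ ^ q) (pivot (suc x) (suc y) q)
    sink = slide-under (⊖ ^ suc x) (there ⊕ (slide-grow y ⊙⊖))

  length-walk : ∀ x y q rest → length (walk x (suc y) q rest) ≡ 2 ℕ.* suc y ℕ.+ length rest
  length-walk x zero    q rest = refl
  length-walk x (suc y) q rest =
    trans (cong (λ l → suc (suc l)) (length-walk (suc x) y q rest)) (shift y (length rest))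
    where
    shift : ∀ y l → suc (suc (2 ℕ.* suc y ℕ.+ l)) ≡ 2 ℕ.* suc (suc y) ℕ.+ l
    shift = ℕ-Ring.solve-∀

  levels : ℕ → ℕ → List Word
  levels r q = walk 0 r q (onward r)
    where
    onward : ℕ → List Word
    onward zero    = (⊙ ∷ ⊕ ^ suc q) ∷ []
    onward (suc r) = (⊕ ∷ ⊖ ^ r ++ ⊕ ∷ ⊙ ∷ ⊕ ^ q) ∷ levels r (suc q)

  levels-linked : ∀ r q → Linked APStep (levels r q)
  levels-linked zero    q = walk-linked 0 0 q _ (slide ⊕⊙ ∷ [-])
  levels-linked (suc r) q =
    walk-linked 0 (suc r) q _ (step flip ∷ slide (slide-under (⊕ ∷ ⊖ ^ r) ⊕⊙) ∷ levels-linked r (suc q))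

  length-levels : ∀ r q → length (levels r q) ≡ suc r ℕ.* suc r ℕ.+ 1
  length-levels zero    q = refl
  length-levels (suc r) q = begin
    length (walk 0 (suc r) q ((⊕ ∷ ⊖ ^ r ++ ⊕ ∷ ⊙ ∷ ⊕ ^ q) ∷ levels r (suc q)))
      ≡⟨ length-walk 0 r q _ ⟩
    2 ℕ.* suc r ℕ.+ suc (length (levels r (suc q)))
      ≡⟨ cong (λ l → 2 ℕ.* suc r ℕ.+ suc l) (length-levels r (suc q)) ⟩
    2 ℕ.* suc r ℕ.+ suc (suc r ℕ.* suc r ℕ.+ 1)
      ≡⟨ expand r ⟩
    suc (suc r) ℕ.* suc (suc r) ℕ.+ 1
      ∎
    where
    open ≡-Reasoning
    expand : ∀ r → 2 ℕ.* suc r ℕ.+ suc (suc r ℕ.* suc r ℕ.+ 1) ≡ suc (suc r) ℕ.* suc (suc r) ℕ.+ 1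
    expand = ℕ-Ring.solve-∀

  apLadder : ℕ → List Word
  apLadder n = march [] ⊙ 0 (suc n) [] (levels n 0)

  apLadder-linked : ∀ n → Linked APStep (apLadder n)
  apLadder-linked n =
    march-linked [] ⊙ (λ x v → slide (slide-grow x ⊙⊖)) 0 (suc n) [] _ (step flip ∷ levels-linked n 0)

  length-apLadder : ∀ n → length (apLadder n) ≡ suc (suc n) ℕ.+ (suc n ℕ.* suc n ℕ.+ 1)
  length-apLadder n =
    trans (length-march [] ⊙ 0 (suc n) [] (levels n 0)) (cong (suc (suc n) ℕ.+_) (length-levels n 0))

  linked-map : ∀ {A B : Set} {P : A → Set} {R : A → A → Set} {S : B → B → Set} (f : A → B) →
               (∀ {a b} → P a → R a b → S (f a) (f b)) →
               ∀ {as} → All P as → Linked R as → Linked S (map f as)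
  linked-map f lift []         []       = []
  linked-map f lift (_ ∷ [])   [-]      = [-]
  linked-map f lift (pa ∷ pas) (r ∷ rs) = lift pa r ∷ linked-map f lift pas rs

  Shaped : ℕ → ℕ → Word → Set
  Shaped n k w = length w ≡ n × weight w ≡ k

  sums : List ℤ → List Word → List ℤ
  sums xs = map (λ w → signedSum w xs)

  length-sums : ∀ xs ws → length (sums xs ws) ≡ length ws
  length-sums xs ws = List.length-map (λ w → signedSum w xs) ws

  module _ {R : Word → Word → Set} (R-shape : ∀ {w w′} → R w w′ → SameShape w w′) where

    chain-shaped : ∀ {n k w ws} → Linked R (w ∷ ws) → Shaped n k w → All (Shaped n k) (w ∷ ws)
    chain-shaped [-]      shaped     = shaped ∷ []
    chain-shaped (r ∷ rs) (len , wt) with R-shape r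
    ... | len′ , wt′ = (len , wt) ∷ chain-shaped rs (trans (sym len′) len , trans (sym wt′) wt)

  sums-∈ : ∀ {xs k ws} → All (Shaped (length xs) k) ws → All (_∈ signedSums k xs) (sums xs ws)
  sums-∈ []                                        = []
  sums-∈ {xs} {ws = w ∷ _} ((len , refl) ∷ shaped) = signedSum∈signedSums w xs len ∷ sums-∈ shaped

  sums-increasing : ∀ {R : Word → Word → Set} {xs k ws} →
                    (∀ {w w′} → R w w′ → length w ≡ length xs → signedSum w xs < signedSum w′ xs) →
                    Linked R ws → All (Shaped (length xs) k) ws → Linked _<_ (sums xs ws)
  sums-increasing raises chain shaped = linked-map _ (λ (len , _) r → raises r len) shaped chain

  increasing⇒unique : ∀ {vs} → Linked _<_ vs → Unique vs
  increasing⇒unique vs↑ = AllPairs.map ℤ.<⇒≢ (Linked.Linked⇒AllPairs ℤ.<-trans vs↑)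

  sums-congruent : ∀ {R : Word → Word → Set} {xs k w ws} m →
                   (∀ {w w′} → R w w′ → length w ≡ length xs →
                     signedSum w′ xs ≡ signedSum w xs ⟨mod m ⟩) →
                   Linked R (w ∷ ws) → All (Shaped (length xs) k) (w ∷ ws) →
                   All (λ v → v ≡ signedSum w xs ⟨mod m ⟩) (sums xs (w ∷ ws))
  sums-congruent m moves chain shaped =
    Linked.Linked⇒All {R = λ u v → v ≡ u ⟨mod m ⟩} (λ v≡u w≡v → ≡mod-trans w≡v v≡u) ≡mod-refl
      (linked-map _ (λ (len , _) r → moves r len) shaped chain)

  signedSum-parity : ∀ w xs → Shaped (length xs) (length xs) w →
                     signedSum w xs ≡ foldr _+_ 0ℤ xs ⟨mod + 2 ⟩
  signedSum-parity w xs (len , wt) =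
    signedSums-parity xs (subst (λ k → signedSum w xs ∈ signedSums k xs) wt (signedSum∈signedSums w xs len))

  -- Arithmetic progressions

  module _ {zs : List ℤ} (zs↑ : Linked _<_ zs) (f : ℕ → ℤ) {m : ℕ}
           (covers : ∀ {i} → i ℕ.< m → f i ∈ zs) where

    private
      between : ∀ {x y z} → Consecutive x y zs → z ∈ zs → x < z → z < y → ⊥
      between = nothing-between (Linked.Linked⇒AllPairs ℤ.<-trans zs↑)

    ascending-gap : (∀ {i j} → i ℕ.< j → f i < f j) →
                    ∀ {i j} → j ℕ.< m → Consecutive (f i) (f j) zs → j ≡ suc i
    ascending-gap f↑ {i} {j} j<m c with ℕ.<-cmp i j
    ... | tri≈ _ refl _ = ⊥-elim (ℤ.<-irrefl refl (Linked⇒consecutive zs↑ c))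
    ... | tri> _ _ j<i  = ⊥-elim (ℤ.<-asym (f↑ j<i) (Linked⇒consecutive zs↑ c))
    ... | tri< i<j _ _ with ℕ.m≤n⇒m<n∨m≡n i<j
    ...   | inj₂ 1+i≡j = sym 1+i≡j
    ...   | inj₁ 1+i<j = ⊥-elim (between c (covers (ℕ.<-trans 1+i<j j<m)) (f↑ (ℕ.n<1+n i)) (f↑ 1+i<j))

    descending-gap : (∀ {i j} → i ℕ.< j → f j < f i) →
                     ∀ {i j} → i ℕ.< m → Consecutive (f i) (f j) zs → i ≡ suc j
    descending-gap f↓ {i} {j} i<m c with ℕ.<-cmp j i
    ... | tri≈ _ refl _ = ⊥-elim (ℤ.<-irrefl refl (Linked⇒consecutive zs↑ c))
    ... | tri> _ _ i<j  = ⊥-elim (ℤ.<-asym (f↓ i<j) (Linked⇒consecutive zs↑ c))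
    ... | tri< j<i _ _ with ℕ.m≤n⇒m<n∨m≡n j<i
    ...   | inj₂ 1+j≡i = sym 1+j≡i
    ...   | inj₁ 1+j<i = ⊥-elim (between c (covers (ℕ.<-trans 1+j<i i<m)) (f↓ 1+j<i) (f↓ (ℕ.n<1+n j)))

  equal-gaps : ∀ {zs} → Linked _<_ zs → IsAP zs → ∃ λ δ → Linked (λ x y → y ≡ x + δ) zs
  equal-gaps {zs} zs↑ (a , d , m , d≢0 , members) with ℤ.<-cmp d 0ℤ
  ... | tri≈ _ d≡0 _ = ⊥-elim (d≢0 d≡0)
  ... | tri> _ _ 0<d = d , consecutive⇒Linked zs gap
    where
    f : ℕ → ℤ
    f i = a + + i * d
    f↑ : ∀ {i j} → i ℕ.< j → f i < f j
    f↑ i<j = ℤ.+-monoʳ-< a (ℤ.*-monoʳ-<-pos d {{ℤ.positive 0<d}} (ℤ.+<+ i<j))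
    covers : ∀ {i} → i ℕ.< m → f i ∈ zs
    covers {i} i<m = Equivalence.from (members (f i)) (i , i<m , refl)
    gap : ∀ {x y} → Consecutive x y zs → y ≡ x + d
    gap {x} {y} c with Equivalence.to (members x) (consecutive-∈ˡ c)
                     | Equivalence.to (members y) (consecutive-∈ʳ c)
    ... | i , _ , refl | j , j<m , refl with ascending-gap zs↑ f covers f↑ {i} {j} j<m c
    ... | refl = next a d (+ i)
      where
      next : ∀ a d x → a + (+ 1 + x) * d ≡ a + x * d + d
      next = solve-∀
  ... | tri< d<0 _ _ = - d , consecutive⇒Linked zs gap
    where
    f : ℕ → ℤ
    f i = a + + i * d
    f↓ : ∀ {i j} → i ℕ.< j → f j < f i
    f↓ i<j = ℤ.+-monoʳ-< a (ℤ.*-monoʳ-<-neg d {{ℤ.negative d<0}} (ℤ.+<+ i<j))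
    covers : ∀ {i} → i ℕ.< m → f i ∈ zs
    covers {i} i<m = Equivalence.from (members (f i)) (i , i<m , refl)
    gap : ∀ {x y} → Consecutive x y zs → y ≡ x + - d
    gap {x} {y} c with Equivalence.to (members x) (consecutive-∈ˡ c)
                     | Equivalence.to (members y) (consecutive-∈ʳ c)
    ... | i , i<m , refl | j , _ , refl with descending-gap zs↑ f covers f↓ {i} {j} i<m c
    ... | refl = previous a d (+ j)
      where
      previous : ∀ a d x → a + x * d ≡ a + (+ 1 + x) * d + - d
      previous = solve-∀

  ⊖^-shaped : ∀ k → Shaped k k (⊖ ^ k ++ [])
  ⊖^-shaped zero    = refl , refl
  ⊖^-shaped (suc k) with ⊖^-shaped k
  ... | len , wt = cong suc len , cong suc wt

  increasing-drop₁ : ∀ {x y zs} → Linked _<_ (x ∷ y ∷ zs) → Linked _<_ (x ∷ zs)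
  increasing-drop₁ (x<y ∷ [-])        = [-]
  increasing-drop₁ (x<y ∷ y<z ∷ zs↑) = ℤ.<-trans x<y y<z ∷ zs↑

  reshape : ∀ {m k ws} (xs : List ℤ) → length xs ≡ m → All (Shaped m k) ws → All (Shaped (length xs) k) ws
  reshape xs len = All.map (λ (len′ , wt) → trans len′ (sym len) , wt)

  module Bounds {x₀ x₁ x₂ : ℤ} {T : List ℤ} {m : ℕ} (T-length : length T ≡ suc m)
           (A↑ : Linked _<_ (x₀ ∷ x₁ ∷ x₂ ∷ T)) (A>0 : All (0ℤ <_) (x₀ ∷ x₁ ∷ x₂ ∷ T))
           (x₁≢x₀ : ¬ x₁ ≡ x₀ ⟨mod + 2 ⟩) (x₂≡x₀ : x₂ ≡ x₀ ⟨mod + 2 ⟩) where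

    private
      n h : ℕ
      n = suc m
      h = suc (suc n)

      A A₂ : List ℤ
      A  = x₀ ∷ x₁ ∷ x₂ ∷ T
      A₂ = x₀ ∷ x₂ ∷ T

      A-length : length A ≡ suc h
      A-length = cong (λ m → suc (suc (suc m))) T-length

      A₂-length : length A₂ ≡ h
      A₂-length = cong (λ m → suc (suc m)) T-length

      A₂↑ : Linked _<_ A₂
      A₂↑ = increasing-drop₁ A↑

      A₂>0 : All (0ℤ <_) A₂
      A₂>0 = All.head A>0 ∷ All.tail (All.tail A>0)

      U : List ℤ
      U = sums A₂ (ladder (suc n))

      U-shaped : All (Shaped (length A₂) h) (ladder (suc n))
      U-shaped = reshape A₂ A₂-length (chain-shaped Step-shape (ladder-linked (suc n)) (⊖^-shaped h))

      U! : Unique U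
      U! = increasing⇒unique
             (sums-increasing (λ st len → Step-raises st len A₂↑ A₂>0) (ladder-linked (suc n)) U-shaped)

      ladder≤card₂ : h ℕ.* suc h ℕ.+ 2 ≤ 2 ℕ.* signedSumsetCard h A₂
      ladder≤card₂ = begin
        h ℕ.* suc h ℕ.+ 2              ≡⟨ sym (length-ladder (suc n)) ⟩
        2 ℕ.* length (ladder (suc n))  ≡⟨ cong (2 ℕ.*_) (sym (length-sums A₂ (ladder (suc n)))) ⟩
        2 ℕ.* length U                 ≤⟨ ℕ.*-monoʳ-≤ 2 (unique-≤-signedSumsetCard {h} {A₂} U! (sums-∈ U-shaped)) ⟩
        2 ℕ.* signedSumsetCard h A₂    ∎
        where open ℕ.≤-Reasoning

      C : List ℤ
      C = sums A (hopLadder n)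

      C-shaped : All (Shaped (length A) h) (hopLadder n)
      C-shaped = reshape A A-length (chain-shaped Step-shape (hopLadder-linked n)
                                       (cong suc (proj₁ (⊖^-shaped h)) , proj₂ (⊖^-shaped h)))

      C! : Unique C
      C! = increasing⇒unique
             (sums-increasing (λ st len → Step-raises st len A↑ A>0) (hopLadder-linked n) C-shaped)

      C-parity : All (λ v → v ≡ signedSum (⊙ ∷ ⊖ ^ h ++ []) A ⟨mod + 2 ⟩) C
      C-parity = sums-congruent (+ 2) (λ st len → Step-even st len x₂≡x₀) (hopLadder-linked n) C-shaped

      C-disjoint : Disjoint (signedSums h A₂) C
      C-disjoint {v} (v∈ , v∈C) =
        x₁≢x₀ (≡mod-cancelʳ S
          (≡mod-trans (≡mod-sym head≡) (≡mod-trans (≡mod-sym (All.lookup C-parity v∈C)) v≡)))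
        where
        S : ℤ
        S = foldr _+_ 0ℤ (x₂ ∷ T)
        tail-shaped : Shaped (length (x₁ ∷ x₂ ∷ T)) (length (x₁ ∷ x₂ ∷ T)) (⊖ ^ h ++ [])
        tail-shaped = trans (proj₁ (⊖^-shaped h)) (sym A₂-length) ,
                      trans (proj₂ (⊖^-shaped h)) (sym A₂-length)
        head≡ : signedSum (⊙ ∷ ⊖ ^ h ++ []) A ≡ x₁ + S ⟨mod + 2 ⟩
        head≡ = subst (λ u → u ≡ x₁ + S ⟨mod + 2 ⟩) (sym (ℤ.+-identityˡ _))
                  (signedSum-parity (⊖ ^ h ++ []) (x₁ ∷ x₂ ∷ T) tail-shaped)
        v≡ : v ≡ x₀ + S ⟨mod + 2 ⟩
        v≡ = signedSums-parity A₂ (subst (λ k → v ∈ signedSums k A₂) (sym A₂-length) v∈)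

      card₂+C≤card : signedSumsetCard h A₂ ℕ.+ length C ≤ signedSumsetCard h A
      card₂+C≤card = signedSumsetCard-insert {h} {x₀} {x₁} {x₂ ∷ T} C! (sums-∈ C-shaped) C-disjoint

      length-C : 2 ℕ.* length C ≡ (n ℕ.+ 3) ℕ.* (n ℕ.+ 4)
      length-C = trans (cong (2 ℕ.*_) (length-sums A (hopLadder n))) (length-hopLadder n)

    growth : 2 ℕ.* signedSumsetCard h A₂ ℕ.+ h ℕ.* (h ℕ.+ 1) ℕ.+ 2 ℕ.* h ≤ 2 ℕ.* signedSumsetCard h A
    growth = begin
      2 ℕ.* c₂ ℕ.+ h ℕ.* (h ℕ.+ 1) ℕ.+ 2 ℕ.* h        ≤⟨ ℕ.m≤m+n _ 2 ⟩
      2 ℕ.* c₂ ℕ.+ h ℕ.* (h ℕ.+ 1) ℕ.+ 2 ℕ.* h ℕ.+ 2  ≡⟨ regroup c₂ n ⟩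
      2 ℕ.* c₂ ℕ.+ (n ℕ.+ 3) ℕ.* (n ℕ.+ 4)            ≡⟨ cong (2 ℕ.* c₂ ℕ.+_) (sym length-C) ⟩
      2 ℕ.* c₂ ℕ.+ 2 ℕ.* length C                     ≡⟨ sym (ℕ.*-distribˡ-+ 2 c₂ (length C)) ⟩
      2 ℕ.* (c₂ ℕ.+ length C)                         ≤⟨ ℕ.*-monoʳ-≤ 2 card₂+C≤card ⟩
      2 ℕ.* signedSumsetCard h A                      ∎
      where
      open ℕ.≤-Reasoning
      c₂ : ℕ
      c₂ = signedSumsetCard h A₂
      regroup : ∀ c n →
                2 ℕ.* c ℕ.+ suc (suc n) ℕ.* (suc (suc n) ℕ.+ 1) ℕ.+ 2 ℕ.* suc (suc n) ℕ.+ 2 ≡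
                2 ℕ.* c ℕ.+ (n ℕ.+ 3) ℕ.* (n ℕ.+ 4)
      regroup = ℕ-Ring.solve-∀

    lower-bound : h ℕ.* h ℕ.+ 2 ℕ.* h ℕ.+ 2 ≤ signedSumsetCard h A
    lower-bound = ℕ.*-cancelˡ-≤ 2 (begin
      2 ℕ.* (h ℕ.* h ℕ.+ 2 ℕ.* h ℕ.+ 2)                ≡⟨ regroup n ⟩
      (h ℕ.* suc h ℕ.+ 2) ℕ.+ (n ℕ.+ 3) ℕ.* (n ℕ.+ 4)
        ≤⟨ ℕ.+-mono-≤ ladder≤card₂ (ℕ.≤-reflexive (sym length-C)) ⟩
      2 ℕ.* c₂ ℕ.+ 2 ℕ.* length C                      ≡⟨ sym (ℕ.*-distribˡ-+ 2 c₂ (length C)) ⟩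
      2 ℕ.* (c₂ ℕ.+ length C)                          ≤⟨ ℕ.*-monoʳ-≤ 2 card₂+C≤card ⟩
      2 ℕ.* signedSumsetCard h A                       ∎)
      where
      open ℕ.≤-Reasoning
      c₂ : ℕ
      c₂ = signedSumsetCard h A₂
      regroup : ∀ n → 2 ℕ.* (suc (suc n) ℕ.* suc (suc n) ℕ.+ 2 ℕ.* suc (suc n) ℕ.+ 2) ≡
                      (suc (suc n) ℕ.* suc (suc (suc n)) ℕ.+ 2) ℕ.+ (n ℕ.+ 3) ℕ.* (n ℕ.+ 4)
      regroup = ℕ-Ring.solve-∀

    module _ (A₂-AP : IsAP A₂) where

      private
        δ : ℤ
        δ = proj₁ (equal-gaps A₂↑ A₂-AP)

        A₂-ap : Linked (λ x y → y ≡ x + δ) A₂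
        A₂-ap = proj₂ (equal-gaps A₂↑ A₂-AP)

        δ≡ : δ ≡ x₂ - x₀
        δ≡ = solve-for δ x₀ x₂ (Linked.head A₂-ap)
          where
          solve-for : ∀ δ x₀ x₂ → x₂ ≡ x₀ + δ → δ ≡ x₂ - x₀
          solve-for δ x₀ x₂ refl = cancel x₀ δ
            where
            cancel : ∀ x δ → δ ≡ x + δ - x
            cancel = solve-∀

        0<δ : 0ℤ < δ
        0<δ = subst (0ℤ <_) (sym δ≡) (0<difference (Linked.head A₂↑))

        2∣δ : + 2 ∣ δ
        2∣δ = subst (+ 2 ∣_) (sym δ≡) (divides-difference x₂≡x₀)

        A₂≡x₀ : All (λ x → x ≡ x₀ ⟨mod + 2 ⟩) A₂
        A₂≡x₀ = Linked.Linked⇒All (λ v≡u w≡v → ≡mod-trans w≡v v≡u) ≡mod-refl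
                  (Linked.map (λ eq → increment-≡mod eq 2∣δ) A₂-ap)

        W : List ℤ
        W = sums A₂ (apLadder n)

        W-shaped : All (Shaped (length A₂) (suc n)) (apLadder n)
        W-shaped = reshape A₂ A₂-length (chain-shaped APStep-shape (apLadder-linked n)
                                           (cong suc (proj₁ (⊖^-shaped (suc n))) , proj₂ (⊖^-shaped (suc n))))

        W↑ : Linked _<_ W
        W↑ = sums-increasing (λ st len → APStep-raises st len A₂-ap 0<δ A₂>0) (apLadder-linked n) W-shaped

        W⊆ : All (_∈ signedSums (suc n) A₂) W
        W⊆ = sums-∈ W-shaped

        w₀ : ℤ
        w₀ = signedSum (⊙ ∷ ⊖ ^ suc n ++ []) A₂

        Q : List ℤ
        Q = (- x₁ + w₀) ∷ map (λ w → x₁ + w) W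

        Q↑ : Linked _<_ Q
        Q↑ = ℤ.+-monoˡ-< w₀ (ℤ.<-trans (ℤ.neg-mono-< 0<x₁) 0<x₁) ∷
             Linked.map⁺ (Linked.map (ℤ.+-monoʳ-< x₁) W↑)
          where
          0<x₁ : 0ℤ < x₁
          0<x₁ = All.head (All.tail A>0)

        Q⊆ : All (_∈ signedSums h A) Q
        Q⊆ = ∈-signedSums-insert ⊖ (suc n) x₀ x₁ (x₂ ∷ T) (All.head W⊆) ∷
             All.map⁺ (All.map (∈-signedSums-insert ⊕ (suc n) x₀ x₁ (x₂ ∷ T)) W⊆)

        Q-parity : All (λ u → u ≡ x₁ + + suc n * x₀ ⟨mod + 2 ⟩) Q
        Q-parity = ≡mod-+ (-x≡x x₁) (All.head W-parity) ∷
                   All.map⁺ (All.map (≡mod-+ (≡mod-refl {a = x₁})) W-parity)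
          where
          W-parity : All (λ w → w ≡ + suc n * x₀ ⟨mod + 2 ⟩) W
          W-parity = All.map (signedSums-uniform-parity (suc n) A₂ A₂≡x₀) W⊆

        Q-disjoint : Disjoint (signedSums h A₂) Q
        Q-disjoint {v} (v∈ , v∈Q) =
          x₁≢x₀ (≡mod-cancelʳ (+ suc n * x₀) (≡mod-trans (≡mod-sym (All.lookup Q-parity v∈Q)) v≡))
          where
          v≡ : v ≡ x₀ + + suc n * x₀ ⟨mod + 2 ⟩
          v≡ = subst (λ t → v ≡ t ⟨mod + 2 ⟩) (sym (one-more x₀ (+ suc n)))
                 (signedSums-uniform-parity h A₂ A₂≡x₀ v∈)

        card₂+Q≤card : signedSumsetCard h A₂ ℕ.+ length Q ≤ signedSumsetCard h A
        card₂+Q≤card =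
          signedSumsetCard-insert {h} {x₀} {x₁} {x₂ ∷ T} (increasing⇒unique Q↑) Q⊆ Q-disjoint

        length-Q : length Q ≡ suc (suc (suc n) ℕ.+ (suc n ℕ.* suc n ℕ.+ 1))
        length-Q = cong suc (trans (List.length-map _ W) (trans (length-sums A₂ (apLadder n)) (length-apLadder n)))

      lower-bound-AP : h ℕ.* (3 ℕ.* h ∸ 1) ℕ.+ 8 ≤ 2 ℕ.* signedSumsetCard h A
      lower-bound-AP = begin
        h ℕ.* (3 ℕ.* h ∸ 1) ℕ.+ 8                 ≡⟨ regroup ⟩
        (h ℕ.* suc h ℕ.+ 2) ℕ.+ 2 ℕ.* length Q    ≤⟨ ℕ.+-monoˡ-≤ (2 ℕ.* length Q) ladder≤card₂ ⟩
        2 ℕ.* c₂ ℕ.+ 2 ℕ.* length Q               ≡⟨ sym (ℕ.*-distribˡ-+ 2 c₂ (length Q)) ⟩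
        2 ℕ.* (c₂ ℕ.+ length Q)                   ≤⟨ ℕ.*-monoʳ-≤ 2 card₂+Q≤card ⟩
        2 ℕ.* signedSumsetCard h A                ∎
        where
        open ℕ.≤-Reasoning
        c₂ : ℕ
        c₂ = signedSumsetCard h A₂
        -- 3 * h ∸ 1 is written out in the normal form it reduces to, which the solver can handle.
        expand : ∀ n → suc (suc n) ℕ.* suc (n ℕ.+ (suc (suc n) ℕ.+ (suc (suc n) ℕ.+ 0))) ℕ.+ 8 ≡
                       (suc (suc n) ℕ.* suc (suc (suc n)) ℕ.+ 2) ℕ.+
                       2 ℕ.* suc (suc (suc n) ℕ.+ (suc n ℕ.* suc n ℕ.+ 1))
        expand = ℕ-Ring.solve-∀
        regroup : h ℕ.* (3 ℕ.* h ∸ 1) ℕ.+ 8 ≡ (h ℕ.* suc h ℕ.+ 2) ℕ.+ 2 ℕ.* length Q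
        regroup = trans (expand n) (cong (λ l → (h ℕ.* suc h ℕ.+ 2) ℕ.+ 2 ℕ.* l) (sym length-Q))

      module _ (2∣x₁ : + 2 ∣ x₁) where

        private
          A₂-pairs : Linked (λ x y → x ≡ y ⟨mod + 2 ⟩) A₂
          A₂-pairs = Linked.map (λ eq → ≡mod-sym (increment-≡mod eq 2∣δ)) A₂-ap

          raises : ∀ {w w′} → EvenStep w w′ → length w ≡ length A₂ →
                   signedSum w A₂ < signedSum w′ A₂
          raises st len = EvenStep-raises st len A₂↑ A₂>0

          mod4 : ∀ {w w′} → EvenStep w w′ → length w ≡ length A₂ →
                 signedSum w′ A₂ ≡ signedSum w A₂ ⟨mod + 4 ⟩
          mod4 st len = EvenStep-mod4 st len A₂-pairs

          E₀ E₁ : List ℤ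
          E₀ = sums A₂ (evenLadder n)
          E₁ = sums A₂ (oddLadder m)

          E₀-shaped : All (Shaped (length A₂) h) (evenLadder n)
          E₀-shaped = reshape A₂ A₂-length (chain-shaped EvenStep-shape (evenLadder-linked n) (⊖^-shaped h))

          E₁-shaped : All (Shaped (length A₂) h) (oddLadder m)
          E₁-shaped = reshape A₂ A₂-length
            (chain-shaped EvenStep-shape (oddLadder-linked m)
              (cong suc (proj₁ (⊖^-shaped (suc n))) , cong suc (proj₂ (⊖^-shaped (suc n)))))

          -- The two ladders start one flip of x₀ apart, and 2x₀ is not divisible by 4.
          E-disjoint : Disjoint E₀ E₁
          E-disjoint {u} (u∈E₀ , u∈E₁) =
            x₁≢x₀ (congruent (∣m∣n⇒∣m-n 2∣x₁ (half (≡mod-cancelʳ s x₀≡-x₀))))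
            where
            s : ℤ
            s = signedSum (⊖ ^ suc n ++ []) (x₂ ∷ T)
            x₀≡-x₀ : x₀ + s ≡ - x₀ + s ⟨mod + 4 ⟩
            x₀≡-x₀ =
              ≡mod-trans (≡mod-sym (All.lookup (sums-congruent (+ 4) mod4 (oddLadder-linked m) E₁-shaped) u∈E₁))
                         (All.lookup (sums-congruent (+ 4) mod4 (evenLadder-linked n) E₀-shaped) u∈E₀)
            half : ∀ {x} → x ≡ - x ⟨mod + 4 ⟩ → + 2 ∣ x
            half {x} (congruent (divides q eq)) =
              divides q (ℤ.*-cancelʳ-≡ x (q * + 2) (+ 2) (trans (double x) (trans eq (regroup q))))
              where
              double : ∀ x → x * + 2 ≡ x - - x
              double = solve-∀
              regroup : ∀ q → q * + 4 ≡ q * + 2 * + 2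
              regroup = solve-∀

          E≤card₂ : length E₀ ℕ.+ length E₁ ≤ signedSumsetCard h A₂
          E≤card₂ = subst (_≤ signedSumsetCard h A₂) (List.length-++ E₀)
            (unique-≤-signedSumsetCard {h} {A₂}
              (Unique.++⁺ (increasing⇒unique (sums-increasing raises (evenLadder-linked n) E₀-shaped))
                          (increasing⇒unique (sums-increasing raises (oddLadder-linked m) E₁-shaped)) E-disjoint)
              (All.++⁺ (sums-∈ E₀-shaped) (sums-∈ E₁-shaped)))

          length-E : length E₀ ℕ.+ length E₁ ≡ (m ℕ.+ 2) ℕ.* (m ℕ.+ 2) ℕ.+ (m ℕ.+ 4)
          length-E = trans (cong₂ ℕ._+_ (length-sums A₂ (evenLadder n)) (length-sums A₂ (oddLadder m)))
                           (length-ladders m)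

        lower-bound-AP-even : 2 ℕ.* h ℕ.* (h ∸ 1) ≤ signedSumsetCard h A
        lower-bound-AP-even = begin
          2 ℕ.* h ℕ.* (h ∸ 1)                        ≤⟨ ℕ.m≤m+n _ 5 ⟩
          2 ℕ.* h ℕ.* (h ∸ 1) ℕ.+ 5                  ≡⟨ regroup ⟩
          (length E₀ ℕ.+ length E₁) ℕ.+ length Q     ≤⟨ ℕ.+-monoˡ-≤ (length Q) E≤card₂ ⟩
          signedSumsetCard h A₂ ℕ.+ length Q         ≤⟨ card₂+Q≤card ⟩
          signedSumsetCard h A                       ∎
          where
          open ℕ.≤-Reasoning
          expand : ∀ m → 2 ℕ.* suc (suc (suc m)) ℕ.* suc (suc m) ℕ.+ 5 ≡
                         ((m ℕ.+ 2) ℕ.* (m ℕ.+ 2) ℕ.+ (m ℕ.+ 4)) ℕ.+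
                         suc (suc (suc (suc m)) ℕ.+ (suc (suc m) ℕ.* suc (suc m) ℕ.+ 1))
          expand = ℕ-Ring.solve-∀
          regroup : 2 ℕ.* h ℕ.* (h ∸ 1) ℕ.+ 5 ≡ (length E₀ ℕ.+ length E₁) ℕ.+ length Q
          regroup = trans (expand m) (cong₂ ℕ._+_ (sym length-E) (sym length-Q))

open SignedSumChains using (module Bounds; _≡_⟨mod_⟩; congruent)
open import Data.Nat using (ℕ; _≤_; _<_; _+_; _*_; _∸_; suc; s≤s)
import Data.Nat.Properties as ℕ
open import Data.Integer using (ℤ; +_; _-_) renaming (_<_ to _<ℤ_)
open import Data.Integer.Divisibility using (_∣_)
open import Data.Integer.Divisibility.Signed using (∣ᵤ⇒∣; ∣⇒∣ᵤ)
open import Data.List using (List; _∷_; map; upTo; applyUpTo; length)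
open import Data.List.Properties using (map-applyUpTo; length-map; length-applyUpTo)
open import Data.List.Relation.Unary.All using (All)
import Data.List.Relation.Unary.All.Properties as All
open import Data.List.Relation.Unary.Linked using (Linked)
import Data.List.Relation.Unary.Linked.Properties as Linked
open import Data.Product using (_×_; _,_)
open import Relation.Binary.PropositionalEquality using (_≡_; sym; trans; cong; subst)
open import Relation.Nullary using (¬_)

lemma6 : (h : ℕ) → 4 ≤ h → (a : ℕ → ℤ)
  → (∀ i → i ≤ h → + 0 <ℤ a i)
  → (∀ i j → i < j → j ≤ h → a i <ℤ a j)
  → ¬ ((+ 2) ∣ (a 1 - a 0))
  → (+ 2) ∣ (a 2 - a 0)
  → let A  = map a (upTo (suc h))
        A₂ = a 0 ∷ map (λ i → a (2 + i)) (upTo (h ∸ 1))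
    in (2 * signedSumsetCard h A₂ + h * (h + 1) + 2 * h ≤ 2 * signedSumsetCard h A)
       × (¬ IsAP A₂ → h * h + 2 * h + 2 ≤ signedSumsetCard h A)
       × (IsAP A₂ → ¬ ((+ 2) ∣ a 1) → h * (3 * h ∸ 1) + 8 ≤ 2 * signedSumsetCard h A)
       × (h ≡ 4 → IsAP A₂ → (+ 2) ∣ a 1 → 26 ≤ signedSumsetCard h A)
       × (5 ≤ h → IsAP A₂ → (+ 2) ∣ a 1 → 2 * h * (h ∸ 1) ≤ signedSumsetCard h A)
lemma6 h@(suc (suc (suc (suc k)))) (s≤s (s≤s (s≤s (s≤s _)))) a pos mono odd even =
  -- The second bound needs no assumption on A₂ and the third none on a₁; at h = 4 the fourth is the third.
  subst (λ c → 2 * c + h * (h + 1) + 2 * h ≤ 2 * signedSumsetCard h A)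
        (cong (signedSumsetCard h) (sym A₂≡)) growth ,
  (λ _ → lower-bound) ,
  (λ ap _ → lower-bound-AP (transport ap)) ,
  (λ h≡4 ap _ → ℕ.*-cancelˡ-≤ 2
    (subst (λ j → j * (3 * j ∸ 1) + 8 ≤ 2 * signedSumsetCard h A) h≡4 (lower-bound-AP (transport ap)))) ,
  (λ _ ap 2∣a₁ → lower-bound-AP-even (transport ap) (∣ᵤ⇒∣ 2∣a₁))
  where
  A T : List ℤ
  A = map a (upTo (suc h))
  T = map a (applyUpTo (λ i → 3 + i) (suc (suc k)))

  A₂≡ : a 0 ∷ map (λ i → a (2 + i)) (upTo (h ∸ 1)) ≡ a 0 ∷ a 2 ∷ T
  A₂≡ = cong (λ L → a 0 ∷ a 2 ∷ L)
    (trans (map-applyUpTo suc (λ i → a (2 + i)) (suc (suc k)))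
           (sym (map-applyUpTo (λ i → 3 + i) a (suc (suc k)))))

  transport : IsAP (a 0 ∷ map (λ i → a (2 + i)) (upTo (h ∸ 1))) → IsAP (a 0 ∷ a 2 ∷ T)
  transport = subst IsAP A₂≡

  T-length : length T ≡ suc (suc k)
  T-length = trans (length-map a (applyUpTo (λ i → 3 + i) (suc (suc k))))
                   (length-applyUpTo (λ i → 3 + i) (suc (suc k)))

  A↑ : Linked _<ℤ_ A
  A↑ = Linked.map⁺
         (Linked.applyUpTo⁺₁ (λ i → i) (suc h) (λ {i} i<h → mono i (suc i) (ℕ.n<1+n i) (ℕ.≤-pred i<h)))

  A>0 : All (+ 0 <ℤ_) A
  A>0 = All.map⁺ (All.applyUpTo⁺₁ (λ i → i) (suc h) (λ {i} i≤h → pos i (ℕ.≤-pred i≤h)))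

  a₁≢a₀ : ¬ a 1 ≡ a 0 ⟨mod + 2 ⟩
  a₁≢a₀ (congruent 2∣) = odd (∣⇒∣ᵤ 2∣)

  a₂≡a₀ : a 2 ≡ a 0 ⟨mod + 2 ⟩
  a₂≡a₀ = congruent (∣ᵤ⇒∣ even)

  open Bounds {a 0} {a 1} {a 2} {T} {suc k} T-length A↑ A>0 a₁≢a₀ a₂≡a₀
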